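{- Let $n\ge5$. Let $\Phi:\mathbb{R}^{2n-8}\to\mathbb{R}^{2n-8}$ be the rational map $\Phi(a_1,b_1,a_2,b_2,\dots,a_{n-4},b_{n-4})=(b_1,a_2,b_2,\dots,a_{n-4},b_{n-4},Q)$, where $Q=\dfrac{1+b_{n-4}V(a_1,b_1,\dots,b_{n-6},a_{n-5})-V(a_1,b_1,\dots,b_{n-7},a_{n-6})}{V(a_1,b_1,\dots,b_{n-5},a_{n-4})}$. Then $\Phi^{2n}=\mathrm{id}$.
   Context: For $m\ge1$, $V(a_1,b_1,a_2,\dots,b_{m-1},a_m)$ denotes the determinant of the $m\times m$ matrix $(m_{rc})$ with $m_{rr}=a_r$, $m_{r,r+1}=b_r$, $m_{r,r+2}=1$, $m_{r+1,r}=1$, and all other entries $0$. By convention $V$ of the empty sequence ($m=0$) equals $1$ and $V$ with $m=-1$ equals $0$. -}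

module Defs where

open import Level using (Level; suc; _⊔_)
open import Algebra.Bundles using (CommutativeRing)
open import Data.Nat as ℕ using (ℕ; zero; _∸_; _<_)
import Data.Nat.Properties as ℕP
open import Data.Fin using (Fin; toℕ; punchIn)
import Data.Fin as Fin
open import Data.Product using (Σ; _×_)
open import Relation.Nullary using (¬_; yes; no)
open import Relation.Binary.PropositionalEquality using (_≡_)

record Field (c ℓ : Level) : Set (suc (c ⊔ ℓ)) where
  field
    commutativeRing : CommutativeRing c ℓ
  open CommutativeRing commutativeRing public
  field
    1≉0     : ¬ (1# ≈ 0#)
    inverse : ∀ x → ¬ (x ≈ 0#) → Σ Carrier (λ y → x * y ≈ 1#)

module _ {c ℓ} (F : Field c ℓ) where
  open Field F

  natF : ℕ → Carrier
  natF zero      = 0#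
  natF (ℕ.suc k) = 1# + natF k

  CharZero : Set ℓ
  CharZero = ∀ k → ¬ (natF (ℕ.suc k) ≈ 0#)

  sumF : ∀ k → (Fin k → Carrier) → Carrier
  sumF zero      f = 0#
  sumF (ℕ.suc k) f = f Fin.zero + sumF k (λ i → f (Fin.suc i))

  sign : ℕ → Carrier
  sign zero      = 1#
  sign (ℕ.suc j) = - sign j

  det : ∀ k → (Fin k → Fin k → Carrier) → Carrier
  det zero      M = 1#
  det (ℕ.suc k) M =
    sumF (ℕ.suc k) (λ j → sign (toℕ j) * (M Fin.zero j *
      det k (λ r s → M (Fin.suc r) (punchIn j s))))

  -- The m×m matrix of the paper (0-indexed rows r, columns s here;
  -- a, b are 1-indexed: a 1 = a₁, b 1 = b₁):
  -- entries (r,r) = a_{r+1}, (r,r+1) = b_{r+1}, (r,r+2) = 1, (r+1,r) = 1, else 0.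
  bandEntry : (ℕ → Carrier) → (ℕ → Carrier) → ℕ → ℕ → Carrier
  bandEntry a b r s with s ℕ.≟ r | s ℕ.≟ ℕ.suc r | s ℕ.≟ ℕ.suc (ℕ.suc r) | r ℕ.≟ ℕ.suc s
  ... | yes _ | _     | _     | _     = a (ℕ.suc r)
  ... | no _  | yes _ | _     | _     = b (ℕ.suc r)
  ... | no _  | no _  | yes _ | _     = 1#
  ... | no _  | no _  | no _  | yes _ = 1#
  ... | no _  | no _  | no _  | no _  = 0#

  V : ℕ → (ℕ → Carrier) → (ℕ → Carrier) → Carrier
  V m a b = det m (λ r s → bandEntry a b (toℕ r) (toℕ s))

  -- W k = V of length k-1, with the convention W 0 = V_{-1} = 0
  W : ℕ → (ℕ → Carrier) → (ℕ → Carrier) → Carrier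
  W zero      a b = 0#
  W (ℕ.suc k) a b = V k a b

  -- coordinate j (0-indexed) of a point of F^d, and 0 out of range
  at : ∀ {d} → (Fin d → Carrier) → ℕ → Carrier
  at {zero}    x j         = 0#
  at {ℕ.suc d} x zero      = x Fin.zero
  at {ℕ.suc d} x (ℕ.suc j) = at (λ i → x (Fin.suc i)) j

  -- a point x = (a₁,b₁,a₂,b₂,…) of F^d; a i and b i for i ≥ 1
  aCoord bCoord : ∀ {d} → (Fin d → Carrier) → ℕ → Carrier
  aCoord x i = at x (2 ℕ.* (i ∸ 1))
  bCoord x i = at x (2 ℕ.* i ∸ 1)

  dim : ℕ → ℕ
  dim n = 2 ℕ.* (n ∸ 4)

  -- y = Φ(x): Φ is defined at x (the denominator V(a₁,…,a_{n-4}) is nonzero),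
  -- y_j = x_{j+1} for the first 2n-9 coordinates, and the last coordinate y_last = Q,
  -- i.e. V(a₁,…,a_{n-4}) * y_last = 1 + b_{n-4} V(a₁,…,a_{n-5}) - V(a₁,…,a_{n-6}).
  PhiStep : (n : ℕ) → (Fin (dim n) → Carrier) → (Fin (dim n) → Carrier) → Set ℓ
  PhiStep n x y =
    ¬ (V (n ∸ 4) (aCoord x) (bCoord x) ≈ 0#)
    × (∀ (j : Fin (dim n)) → ℕ.suc (toℕ j) < dim n → y j ≈ at x (ℕ.suc (toℕ j)))
    × (∀ (j : Fin (dim n)) → ℕ.suc (toℕ j) ≡ dim n →
         V (n ∸ 4) (aCoord x) (bCoord x) * y j
           ≈ (1# + bCoord x (n ∸ 4) * V (n ∸ 5) (aCoord x) (bCoord x))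
               - W (n ∸ 5) (aCoord x) (bCoord x))

module Submission where

-- The coordinates of all iterates x₀, x₁, … of Φ are read off one sequence z,
-- xₖ = (z k, z (k+1), …, z (k+2m−1)) with m = n − 4, and V evaluated at xₖ is the entry D(k,m) of
-- the array D(k,l) = V(z k, z (k+1), …, z (k+2l−2)).  This array satisfies the condensation
-- (Desnanot–Jacobi) identity D(k+1,l) = D(k,l) D(k+2,l) − D(k,l+1) D(k+2,l−1).  The equation defining
-- Φ says that row m+1 of D is constantly 1 while row m does not vanish; condensation then forces rows
-- m+2 and m+3 to vanish and row m+4 to be 1 again.  Expanding D(k,m+5) along its last and along its
-- first row now gives z (k + 2(m+4)) = z k: the sequence z has period 2n, hence Φ²ⁿ = id.

open import Defs

open import Algebra.Bundles using (CommutativeRing; RawRing)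
open import Algebra.Solver.Ring.AlmostCommutativeRing using (_-Raw-AlmostCommutative⟶_; fromCommutativeRing)
open import Data.Fin.Base as Fin using (Fin; toℕ; punchIn)
import Data.Fin.Properties as Fin
open import Data.Integer.Base as ℤ using (ℤ; +_; -[1+_]; _⊖_; _◃_)
import Data.Integer.Properties as ℤ
import Data.Maybe.Base as Maybe
open import Data.Nat.Base as ℕ using (ℕ; zero; suc; _∸_; _<_; _≤_)
import Data.Nat.Properties as ℕ
open import Data.Nat.Tactic.RingSolver using (solve-∀)
open import Data.Product.Base using (_,_; proj₁; proj₂)
open import Data.Sign.Base as Sign using (Sign)
open import Data.Sum.Base using (inj₁; inj₂)
open import Function.Base using (_∘_)
open import Relation.Binary.PropositionalEquality as ≡ using (_≡_; _≢_)
open import Relation.Nullary.Decidable.Core using (yes; no; dec⇒maybe)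
open import Relation.Nullary.Negation.Core using (¬_; contradiction)

-- The ring solver with coefficients in ℤ, whose equality it can decide, read in R along the canonical map.
module IntegerRingSolver {c ℓ} (R : CommutativeRing c ℓ) where
  open CommutativeRing R
  open import Algebra.Properties.Ring ring
    using (-1*x≈-x; -0#≈0#; -‿involutive; -‿+-comm; //-rightDividesʳ; ⁻¹-anti-homo‿-)
  open import Algebra.Properties.Semiring.Mult.TCOptimised semiring using (_×_; ×-homo-+; ×1-homo-*)
  open import Relation.Binary.Reasoning.Setoid setoid

  ⟦_⟧ : ℤ → Carrier
  ⟦ + n ⟧      = n × 1#
  ⟦ -[1+ n ] ⟧ = - (suc n × 1#)

  -‿homo : ∀ i → ⟦ ℤ.- i ⟧ ≈ - ⟦ i ⟧
  -‿homo (+ zero)  = sym -0#≈0#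
  -‿homo (+ suc n) = refl
  -‿homo -[1+ n ]  = sym (-‿involutive _)

  ∸-homo : ∀ {m n} → n ≤ m → (m ∸ n) × 1# ≈ m × 1# - n × 1#
  ∸-homo {m} {n} n≤m = begin
    (m ∸ n) × 1#                         ≈⟨ //-rightDividesʳ (n × 1#) _ ⟨
    ((m ∸ n) × 1# + n × 1#) - n × 1#     ≈⟨ +-congʳ (×-homo-+ 1# (m ∸ n) n) ⟨
    ((m ∸ n) ℕ.+ n) × 1# - n × 1#        ≡⟨ ≡.cong (λ k → k × 1# - n × 1#) (ℕ.m∸n+n≡m n≤m) ⟩
    m × 1# - n × 1#                      ∎

  ⊖-homo : ∀ m n → ⟦ m ⊖ n ⟧ ≈ m × 1# - n × 1#
  ⊖-homo m n with ℕ.≤-<-connex n m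
  ... | inj₁ n≤m = trans (reflexive (≡.cong ⟦_⟧ (ℤ.⊖-≥ n≤m))) (∸-homo n≤m)
  ... | inj₂ m<n = begin
    ⟦ m ⊖ n ⟧                ≡⟨ ≡.cong ⟦_⟧ (ℤ.⊖-< m<n) ⟩
    ⟦ ℤ.- + (n ∸ m) ⟧        ≈⟨ -‿homo (+ (n ∸ m)) ⟩
    - ((n ∸ m) × 1#)         ≈⟨ -‿cong (∸-homo (ℕ.<⇒≤ m<n)) ⟩
    - (n × 1# - m × 1#)      ≈⟨ ⁻¹-anti-homo‿- _ _ ⟩
    m × 1# - n × 1#          ∎

  +-homo : ∀ i j → ⟦ i ℤ.+ j ⟧ ≈ ⟦ i ⟧ + ⟦ j ⟧
  +-homo (+ m)    (+ n)    = ×-homo-+ 1# m n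
  +-homo (+ m)    -[1+ n ] = ⊖-homo m (suc n)
  +-homo -[1+ m ] (+ n)    = trans (⊖-homo n (suc m)) (+-comm _ _)
  +-homo -[1+ m ] -[1+ n ] = begin
    - (suc (suc (m ℕ.+ n)) × 1#)         ≡⟨ ≡.cong (λ k → - (suc k × 1#)) (ℕ.+-suc m n) ⟨
    - ((suc m ℕ.+ suc n) × 1#)           ≈⟨ -‿cong (×-homo-+ 1# (suc m) (suc n)) ⟩
    - (suc m × 1# + suc n × 1#)          ≈⟨ -‿+-comm _ _ ⟨
    - (suc m × 1#) - suc n × 1#          ∎

  ⟦_⟧ₛ : Sign → Carrier
  ⟦ Sign.+ ⟧ₛ = 1#
  ⟦ Sign.- ⟧ₛ = - 1#

  *-homoₛ : ∀ s t → ⟦ s Sign.* t ⟧ₛ ≈ ⟦ s ⟧ₛ * ⟦ t ⟧ₛ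
  *-homoₛ Sign.+ t      = sym (*-identityˡ _)
  *-homoₛ Sign.- Sign.+ = sym (*-identityʳ _)
  *-homoₛ Sign.- Sign.- = sym (trans (-1*x≈-x (- 1#)) (-‿involutive 1#))

  ◃-homo : ∀ s n → ⟦ s ◃ n ⟧ ≈ ⟦ s ⟧ₛ * (n × 1#)
  ◃-homo s      zero    = sym (zeroʳ _)
  ◃-homo Sign.+ (suc n) = sym (*-identityˡ _)
  ◃-homo Sign.- (suc n) = sym (-1*x≈-x _)

  signAbs-homo : ∀ i → ⟦ i ⟧ ≈ ⟦ ℤ.sign i ⟧ₛ * (ℤ.∣ i ∣ × 1#)
  signAbs-homo (+ n)    = sym (*-identityˡ _)
  signAbs-homo -[1+ n ] = sym (-1*x≈-x _)

  *-homo : ∀ i j → ⟦ i ℤ.* j ⟧ ≈ ⟦ i ⟧ * ⟦ j ⟧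
  *-homo i j = begin
    ⟦ s ◃ ℤ.∣ i ∣ ℕ.* ℤ.∣ j ∣ ⟧                     ≈⟨ ◃-homo s (ℤ.∣ i ∣ ℕ.* ℤ.∣ j ∣) ⟩
    ⟦ s ⟧ₛ * ((ℤ.∣ i ∣ ℕ.* ℤ.∣ j ∣) × 1#)           ≈⟨ *-cong (*-homoₛ (ℤ.sign i) (ℤ.sign j)) (×1-homo-* ℤ.∣ i ∣ ℤ.∣ j ∣) ⟩
    (σ i * σ j) * ((ℤ.∣ i ∣ × 1#) * (ℤ.∣ j ∣ × 1#)) ≈⟨ interchange _ _ _ _ ⟩
    (σ i * (ℤ.∣ i ∣ × 1#)) * (σ j * (ℤ.∣ j ∣ × 1#)) ≈⟨ *-cong (signAbs-homo i) (signAbs-homo j) ⟨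
    ⟦ i ⟧ * ⟦ j ⟧                                   ∎
    where
    open import Algebra.Properties.CommutativeSemigroup *-commutativeSemigroup using (interchange)
    s = ℤ.sign i Sign.* ℤ.sign j
    σ : ℤ → Carrier
    σ k = ⟦ ℤ.sign k ⟧ₛ

  homomorphism : ℤ.+-*-rawRing -Raw-AlmostCommutative⟶ fromCommutativeRing R
  homomorphism = record
    { ⟦_⟧    = ⟦_⟧
    ; +-homo = +-homo
    ; *-homo = *-homo
    ; -‿homo = -‿homo
    ; 0-homo = refl
    ; 1-homo = refl
    }

  open import Algebra.Solver.Ring ℤ.+-*-rawRing (fromCommutativeRing R) homomorphism
    (λ i j → Maybe.map (λ i≡j → reflexive (≡.cong ⟦_⟧ i≡j)) (dec⇒maybe (i ℤ.≟ j)))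
    public using (Polynomial; solve; _:=_; _:+_; _:-_; _:*_; :-_; con)


  :0 :1 : ∀ {n} → Polynomial n
  :0 = con (+ 0)
  :1 = con (+ 1)

  polynomialRawRing : ℕ → RawRing _ _
  polynomialRawRing n = record
    { Carrier = Polynomial n
    ; _≈_     = _≡_
    ; _+_     = _:+_
    ; _*_     = _:*_
    ; -_      = :-_
    ; 0#      = :0
    ; 1#      = :1
    }


shift : ∀ {a} {A : Set a} → ℕ → (ℕ → A) → ℕ → A
shift k f i = f (k ℕ.+ i)

module BandDeterminant {c ℓ} (R : RawRing c ℓ) where
  open RawRing R

  -- bandDet A B (2 + m) is V(A 0, B 0, A 1, …, B (m − 2), A (m − 1)) expanded along its first row;
  -- the offset by two gives V a zero value at lengths −1 and −2.
  bandDet : (ℕ → Carrier) → (ℕ → Carrier) → ℕ → Carrier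
  bandDet A B 0 = 0#
  bandDet A B 1 = 0#
  bandDet A B 2 = 1#
  bandDet A B (suc (suc (suc l))) =
    A 0 * bandDet (shift 1 A) (shift 1 B) (suc (suc l))
    + - (B 0 * bandDet (shift 2 A) (shift 2 B) (suc l))
    + bandDet (shift 3 A) (shift 3 B) l

module BandDeterminantProperties {c ℓ} (R : CommutativeRing c ℓ) where
  open CommutativeRing R
  open IntegerRingSolver R
  open BandDeterminant rawRing public
  open import Relation.Binary.Reasoning.Setoid setoid

  -- bandDet of solver expressions, in which the small cases of identities about bandDet are stated.
  :bandDet : ∀ {n} → (ℕ → Polynomial n) → (ℕ → Polynomial n) → ℕ → Polynomial n
  :bandDet {n} = BandDeterminant.bandDet (polynomialRawRing n)

  bandDet-expandʳ : ∀ l A B → bandDet A B (4 ℕ.+ l) ≈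
    A (1 ℕ.+ l) * bandDet A B (3 ℕ.+ l) - B l * bandDet A B (2 ℕ.+ l) + bandDet A B (1 ℕ.+ l)
  bandDet-expandʳ 0 A B = solve 4 (λ a₀ a₁ b₀ b₁ →
      let a = λ { 0 → a₀ ; _ → a₁ } ; b = λ { 0 → b₀ ; _ → b₁ } ; D = :bandDet a b
      in D 4 := a₁ :* D 3 :- b₀ :* D 2 :+ D 1) refl (A 0) (A 1) (B 0) (B 1)
  bandDet-expandʳ 1 A B = solve 6 (λ a₀ a₁ a₂ b₀ b₁ b₂ →
      let a = λ { 0 → a₀ ; 1 → a₁ ; _ → a₂ } ; b = λ { 0 → b₀ ; 1 → b₁ ; _ → b₂ } ; D = :bandDet a b
      in D 5 := a₂ :* D 4 :- b₁ :* D 3 :+ D 2) refl (A 0) (A 1) (A 2) (B 0) (B 1) (B 2)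
  bandDet-expandʳ 2 A B = solve 8 (λ a₀ a₁ a₂ a₃ b₀ b₁ b₂ b₃ →
      let a = λ { 0 → a₀ ; 1 → a₁ ; 2 → a₂ ; _ → a₃ } ; b = λ { 0 → b₀ ; 1 → b₁ ; 2 → b₂ ; _ → b₃ }
          D = :bandDet a b
      in D 6 := a₃ :* D 5 :- b₂ :* D 4 :+ D 3) refl (A 0) (A 1) (A 2) (A 3) (B 0) (B 1) (B 2) (B 3)
  bandDet-expandʳ (suc (suc (suc l))) A B = begin
    bandDet A B (7 ℕ.+ l)
      ≈⟨ +-cong (+-cong (*-congˡ (bandDet-expandʳ (suc (suc l)) A₁ B₁))
                        (-‿cong (*-congˡ (bandDet-expandʳ (suc l) A₂ B₂))))
                (bandDet-expandʳ l A₃ B₃) ⟩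
    A 0 * (α * D₁ (5 ℕ.+ l) - β * D₁ (4 ℕ.+ l) + D₁ (3 ℕ.+ l))
    - B 0 * (α * D₂ (4 ℕ.+ l) - β * D₂ (3 ℕ.+ l) + D₂ (2 ℕ.+ l))
    + (α * D₃ (3 ℕ.+ l) - β * D₃ (2 ℕ.+ l) + D₃ (1 ℕ.+ l))
      ≈⟨ solve 13 (λ a₀ b₀ α β x₅ x₄ x₃ y₄ y₃ y₂ z₃ z₂ z₁ →
             a₀ :* (α :* x₅ :- β :* x₄ :+ x₃) :- b₀ :* (α :* y₄ :- β :* y₃ :+ y₂) :+ (α :* z₃ :- β :* z₂ :+ z₁)
          := α :* (a₀ :* x₅ :- b₀ :* y₄ :+ z₃) :- β :* (a₀ :* x₄ :- b₀ :* y₃ :+ z₂) :+ (a₀ :* x₃ :- b₀ :* y₂ :+ z₁))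
          refl (A 0) (B 0) α β (D₁ (5 ℕ.+ l)) (D₁ (4 ℕ.+ l)) (D₁ (3 ℕ.+ l))
                               (D₂ (4 ℕ.+ l)) (D₂ (3 ℕ.+ l)) (D₂ (2 ℕ.+ l))
                               (D₃ (3 ℕ.+ l)) (D₃ (2 ℕ.+ l)) (D₃ (1 ℕ.+ l)) ⟩
    α * bandDet A B (6 ℕ.+ l) - β * bandDet A B (5 ℕ.+ l) + bandDet A B (4 ℕ.+ l) ∎
    where
    A₁ = shift 1 A; B₁ = shift 1 B; A₂ = shift 2 A; B₂ = shift 2 B; A₃ = shift 3 A; B₃ = shift 3 B
    α = A (4 ℕ.+ l)
    β = B (3 ℕ.+ l)
    D₁ D₂ D₃ : ℕ → Carrier
    D₁ = bandDet A₁ B₁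
    D₂ = bandDet A₂ B₂
    D₃ = bandDet A₃ B₃

  bandDet-condensation : ∀ l A B → bandDet B (shift 1 A) (1 ℕ.+ l) ≈
    bandDet A B (1 ℕ.+ l) * bandDet (shift 1 A) (shift 1 B) (1 ℕ.+ l)
    - bandDet A B (2 ℕ.+ l) * bandDet (shift 1 A) (shift 1 B) l
  bandDet-condensation 0 A B = solve 0 (:0 := :0 :* :0 :- :1 :* :0) refl
  bandDet-condensation 1 A B = solve 2 (λ a₀ b₀ →
      let a = λ _ → a₀ ; b = λ _ → b₀ ; D = :bandDet a b ; D′ = :bandDet (shift 1 a) (shift 1 b)
      in :bandDet b (shift 1 a) 2 := D 2 :* D′ 2 :- D 3 :* D′ 1) refl (A 0) (B 0)
  bandDet-condensation 2 A B = solve 4 (λ a₀ a₁ b₀ b₁ →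
      let a = λ { 0 → a₀ ; _ → a₁ } ; b = λ { 0 → b₀ ; _ → b₁ }
          D = :bandDet a b ; D′ = :bandDet (shift 1 a) (shift 1 b)
      in :bandDet b (shift 1 a) 3 := D 3 :* D′ 3 :- D 4 :* D′ 2) refl (A 0) (A 1) (B 0) (B 1)
  bandDet-condensation (suc (suc (suc l))) A B = begin
    bandDet B (shift 1 A) (4 ℕ.+ l)
      ≈⟨ +-cong (+-cong (*-congˡ (bandDet-condensation (suc (suc l)) A₁ B₁))
                        (-‿cong (*-congˡ (bandDet-condensation (suc l) A₂ B₂))))
                (bandDet-condensation l A₃ B₃) ⟩
    B 0 * (D₁ (3 ℕ.+ l) * D₂ (3 ℕ.+ l) - D₁ (4 ℕ.+ l) * D₂ (2 ℕ.+ l))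
    - A 1 * (D₂ (2 ℕ.+ l) * D₃ (2 ℕ.+ l) - D₂ (3 ℕ.+ l) * D₃ (1 ℕ.+ l))
    + (D₃ (1 ℕ.+ l) * D₄ (1 ℕ.+ l) - D₃ (2 ℕ.+ l) * D₄ l)
      ≈⟨ solve 10 (λ a₀ b₀ a₁ b₁ x₂ x₃ y₁ y₂ z₀ z₁ →
             b₀ :* ((a₁ :* x₂ :- b₁ :* y₁ :+ z₀) :* x₃ :- (a₁ :* x₃ :- b₁ :* y₂ :+ z₁) :* x₂)
             :- a₁ :* (x₂ :* y₂ :- x₃ :* y₁) :+ (y₁ :* z₁ :- y₂ :* z₀)
          := (a₀ :* (a₁ :* x₂ :- b₁ :* y₁ :+ z₀) :- b₀ :* x₂ :+ y₁) :* (a₁ :* x₃ :- b₁ :* y₂ :+ z₁)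
             :- (a₀ :* (a₁ :* x₃ :- b₁ :* y₂ :+ z₁) :- b₀ :* x₃ :+ y₂) :* (a₁ :* x₂ :- b₁ :* y₁ :+ z₀))
          refl (A 0) (B 0) (A 1) (B 1) (D₂ (2 ℕ.+ l)) (D₂ (3 ℕ.+ l)) (D₃ (1 ℕ.+ l)) (D₃ (2 ℕ.+ l))
                                       (D₄ l) (D₄ (1 ℕ.+ l)) ⟩
    bandDet A B (4 ℕ.+ l) * D₁ (4 ℕ.+ l) - bandDet A B (5 ℕ.+ l) * D₁ (3 ℕ.+ l) ∎
    where
    A₁ = shift 1 A; B₁ = shift 1 B; A₂ = shift 2 A; B₂ = shift 2 B; A₃ = shift 3 A; B₃ = shift 3 B
    D₁ D₂ D₃ D₄ : ℕ → Carrier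
    D₁ = bandDet A₁ B₁
    D₂ = bandDet A₂ B₂
    D₃ = bandDet A₃ B₃
    D₄ = bandDet (shift 4 A) (shift 4 B)

module BandMatrix {c ℓ} (F : Field c ℓ) where
  open Field F
  open BandDeterminantProperties commutativeRing
  open IntegerRingSolver commutativeRing
  open import Relation.Binary.Reasoning.Setoid setoid

  bandEntry-diag : ∀ a b r → bandEntry F a b r r ≡ a (suc r)
  bandEntry-diag a b r with r ℕ.≟ r
  ... | yes _   = ≡.refl
  ... | no r≢r = contradiction ≡.refl r≢r

  bandEntry-super : ∀ a b r → bandEntry F a b r (suc r) ≡ b (suc r)
  bandEntry-super a b r with suc r ℕ.≟ r | suc r ℕ.≟ suc r
  ... | yes 1+r≡r | _     = contradiction (≡.sym 1+r≡r) (ℕ.m≢1+n+m r {0})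
  ... | no _      | yes _ = ≡.refl
  ... | no _      | no ≢  = contradiction ≡.refl ≢

  bandEntry-super² : ∀ a b r → bandEntry F a b r (suc (suc r)) ≡ 1#
  bandEntry-super² a b r with suc (suc r) ℕ.≟ r | suc (suc r) ℕ.≟ suc r | suc (suc r) ℕ.≟ suc (suc r)
  ... | yes 2+r≡r | _         | _     = contradiction (≡.sym 2+r≡r) (ℕ.m≢1+n+m r {1})
  ... | no _      | yes 2+r≡1+r | _   = contradiction (≡.sym 2+r≡1+r) (ℕ.m≢1+n+m (suc r) {0})
  ... | no _      | no _      | yes _ = ≡.refl
  ... | no _      | no _      | no ≢  = contradiction ≡.refl ≢

  bandEntry-sub : ∀ a b s → bandEntry F a b (suc s) s ≡ 1#
  bandEntry-sub a b s with s ℕ.≟ suc s | s ℕ.≟ suc (suc s) | s ℕ.≟ suc (suc (suc s)) | suc s ℕ.≟ suc s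
  ... | yes s≡1+s | _         | _         | _     = contradiction s≡1+s (ℕ.m≢1+n+m s {0})
  ... | no _      | yes s≡2+s | _         | _     = contradiction s≡2+s (ℕ.m≢1+n+m s {1})
  ... | no _      | no _      | yes s≡3+s | _     = contradiction s≡3+s (ℕ.m≢1+n+m s {2})
  ... | no _      | no _      | no _      | yes _ = ≡.refl
  ... | no _      | no _      | no _      | no ≢  = contradiction ≡.refl ≢

  bandEntry-outside : ∀ a b r s → s ≢ r → s ≢ suc r → s ≢ suc (suc r) → r ≢ suc s →
                      bandEntry F a b r s ≡ 0#
  bandEntry-outside a b r s ≢₀ ≢₁ ≢₂ ≢₋₁ with s ℕ.≟ r | s ℕ.≟ suc r | s ℕ.≟ suc (suc r) | r ℕ.≟ suc s
  ... | yes ≡₀ | _      | _      | _       = contradiction ≡₀ ≢₀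
  ... | no _   | yes ≡₁ | _      | _       = contradiction ≡₁ ≢₁
  ... | no _   | no _   | yes ≡₂ | _       = contradiction ≡₂ ≢₂
  ... | no _   | no _   | no _   | yes ≡₋₁ = contradiction ≡₋₁ ≢₋₁
  ... | no _   | no _   | no _   | no _    = ≡.refl

  bandEntry-shift : ∀ a b r s → bandEntry F a b (suc r) (suc s) ≡ bandEntry F (shift 1 a) (shift 1 b) r s
  bandEntry-shift a b r s with s ℕ.≟ r | s ℕ.≟ suc r | s ℕ.≟ suc (suc r) | r ℕ.≟ suc s
  ... | yes ≡.refl | _          | _          | _          = bandEntry-diag a b (suc r)
  ... | no _       | yes ≡.refl | _          | _          = bandEntry-super a b (suc r)
  ... | no _       | no _       | yes ≡.refl | _          = bandEntry-super² a b (suc r)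
  ... | no _       | no _       | no _       | yes ≡.refl = bandEntry-sub a b (suc s)
  ... | no ≢₀      | no ≢₁      | no ≢₂      | no ≢₋₁     =
    bandEntry-outside a b (suc r) (suc s) (≢₀ ∘ ℕ.suc-injective) (≢₁ ∘ ℕ.suc-injective)
                                          (≢₂ ∘ ℕ.suc-injective) (≢₋₁ ∘ ℕ.suc-injective)

  sumF-cong : ∀ k {f g : Fin k → Carrier} → (∀ i → f i ≈ g i) → sumF F k f ≈ sumF F k g
  sumF-cong zero    f≈g = refl
  sumF-cong (suc k) f≈g = +-cong (f≈g Fin.zero) (sumF-cong k (f≈g ∘ Fin.suc))

  sumF≈0 : ∀ k {f : Fin k → Carrier} → (∀ i → f i ≈ 0#) → sumF F k f ≈ 0#
  sumF≈0 zero    f≈0 = refl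
  sumF≈0 (suc k) f≈0 = trans (+-cong (f≈0 Fin.zero) (sumF≈0 k (f≈0 ∘ Fin.suc))) (+-identityʳ 0#)

  det-cong : ∀ k {M N : Fin k → Fin k → Carrier} → (∀ r s → M r s ≈ N r s) → det F k M ≈ det F k N
  det-cong zero    M≈N = refl
  det-cong (suc k) M≈N = sumF-cong (suc k) λ j →
    *-congˡ {sign F (toℕ j)} (*-cong (M≈N Fin.zero j) (det-cong k λ r s → M≈N (Fin.suc r) (punchIn j s)))

  minor : ∀ {k} → (Fin (suc k) → Fin (suc k) → Carrier) → Fin (suc k) → Fin k → Fin k → Carrier
  minor M j r s = M (Fin.suc r) (punchIn j s)

  expansionTerm : ∀ {k} → (Fin (suc k) → Fin (suc k) → Carrier) → Fin (suc k) → Carrier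
  expansionTerm {k} M j = sign F (toℕ j) * (M Fin.zero j * det F k (minor M j))

  expansionTerm≈0ˡ : ∀ {k} (M : Fin (suc k) → Fin (suc k) → Carrier) j → M Fin.zero j ≈ 0# →
                     expansionTerm M j ≈ 0#
  expansionTerm≈0ˡ M j M₀ⱼ≈0 = trans (*-congˡ (trans (*-congʳ M₀ⱼ≈0) (zeroˡ _))) (zeroʳ _)

  expansionTerm≈0ʳ : ∀ {k} (M : Fin (suc k) → Fin (suc k) → Carrier) j → det F k (minor M j) ≈ 0# →
                     expansionTerm M j ≈ 0#
  expansionTerm≈0ʳ M j minor≈0 = trans (*-congˡ (trans (*-congˡ minor≈0) (zeroʳ _))) (zeroʳ _)

  det-zeroColumn : ∀ k (M : Fin (suc k) → Fin (suc k) → Carrier) → (∀ r → M r Fin.zero ≈ 0#) →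
                   det F (suc k) M ≈ 0#
  det-zeroColumn zero    M col≈0 = trans (+-identityʳ _) (expansionTerm≈0ˡ M Fin.zero (col≈0 Fin.zero))
  det-zeroColumn (suc k) M col≈0 = sumF≈0 (2 ℕ.+ k) {expansionTerm M} λ where
    Fin.zero    → expansionTerm≈0ˡ M Fin.zero (col≈0 Fin.zero)
    (Fin.suc j) →
      expansionTerm≈0ʳ M (Fin.suc j) (det-zeroColumn k (minor M (Fin.suc j)) (col≈0 ∘ Fin.suc))

  det-unitColumn : ∀ k (M : Fin (suc k) → Fin (suc k) → Carrier) → (∀ r → M (Fin.suc r) Fin.zero ≈ 0#) →
                   det F (suc k) M ≈ M Fin.zero Fin.zero * det F k (minor M Fin.zero)
  det-unitColumn zero    M _     = trans (+-identityʳ _) (*-identityˡ _)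
  det-unitColumn (suc k) M col≈0 = begin
    1# * (M Fin.zero Fin.zero * D) + sumF F (suc k) (expansionTerm M ∘ Fin.suc)
      ≈⟨ +-congˡ (sumF≈0 (suc k) λ j →
                    expansionTerm≈0ʳ M (Fin.suc j) (det-zeroColumn k (minor M (Fin.suc j)) col≈0)) ⟩
    1# * (M Fin.zero Fin.zero * D) + 0#                   ≈⟨ +-identityʳ _ ⟩
    1# * (M Fin.zero Fin.zero * D)                        ≈⟨ *-identityˡ _ ⟩
    M Fin.zero Fin.zero * D                               ∎
    where
    D = det F (suc k) (minor M Fin.zero)

  V-firstRow : ∀ k a b → V F (3 ℕ.+ k) a b ≈
    a 1 * V F (2 ℕ.+ k) (shift 1 a) (shift 1 b) - b 1 * V F (1 ℕ.+ k) (shift 2 a) (shift 2 b)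
    + V F k (shift 3 a) (shift 3 b)
  V-firstRow k a b = begin
    V F (3 ℕ.+ k) a b
      ≈⟨ +-cong (*-congˡ (*-congˡ minor₀≈X))
                (+-cong (*-congˡ (*-congˡ minor₁≈Y)) (+-cong (*-congˡ (*-congˡ minor₂≈Z)) rest≈0)) ⟩
    1# * (a 1 * X) + (- 1# * (b 1 * (1# * Y)) + (- - 1# * (1# * (1# * (1# * Z))) + 0#))
      ≈⟨ solve 5 (λ a₁ b₁ x y z →
           :1 :* (a₁ :* x) :+ (:- :1 :* (b₁ :* (:1 :* y)) :+ (:- :- :1 :* (:1 :* (:1 :* (:1 :* z))) :+ :0))
        := a₁ :* x :- b₁ :* y :+ z) refl (a 1) (b 1) X Y Z ⟩
    a 1 * X - b 1 * Y + Z  ∎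
    where
    -- Band entries at literal positions compute to 0# or 1#; the refl's below rely on this.
    M : Fin (3 ℕ.+ k) → Fin (3 ℕ.+ k) → Carrier
    M r s = bandEntry F a b (toℕ r) (toℕ s)
    M₁ M₂ : Fin (2 ℕ.+ k) → Fin (2 ℕ.+ k) → Carrier
    M₁ = minor M (Fin.suc Fin.zero)
    M₂ = minor M (Fin.suc (Fin.suc Fin.zero))
    X = V F (2 ℕ.+ k) (shift 1 a) (shift 1 b)
    Y = V F (1 ℕ.+ k) (shift 2 a) (shift 2 b)
    Z = V F k (shift 3 a) (shift 3 b)
    shift² : ∀ r s → bandEntry F a b (2 ℕ.+ r) (2 ℕ.+ s) ≡ bandEntry F (shift 2 a) (shift 2 b) r s
    shift² r s = ≡.trans (bandEntry-shift a b (suc r) (suc s)) (bandEntry-shift (shift 1 a) (shift 1 b) r s)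
    shift³ : ∀ r s → bandEntry F a b (3 ℕ.+ r) (3 ℕ.+ s) ≡ bandEntry F (shift 3 a) (shift 3 b) r s
    shift³ r s = ≡.trans (shift² (suc r) (suc s)) (bandEntry-shift (shift 2 a) (shift 2 b) r s)
    minor₀≈X : det F (2 ℕ.+ k) (minor M Fin.zero) ≈ X
    minor₀≈X = det-cong (2 ℕ.+ k) λ r s → reflexive (bandEntry-shift a b (toℕ r) (toℕ s))
    minor₁≈Y : det F (2 ℕ.+ k) M₁ ≈ 1# * Y
    minor₁≈Y = trans (det-unitColumn (1 ℕ.+ k) M₁ (λ _ → refl))
                     (*-congˡ (det-cong (1 ℕ.+ k) λ r s → reflexive (shift² (toℕ r) (toℕ s))))
    minor₂≈Z : det F (2 ℕ.+ k) M₂ ≈ 1# * (1# * Z)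
    minor₂≈Z = trans (det-unitColumn (1 ℕ.+ k) M₂ (λ _ → refl))
             (*-congˡ (trans (det-unitColumn k (minor M₂ Fin.zero) (λ _ → refl))
             (*-congˡ (det-cong k λ r s → reflexive (shift³ (toℕ r) (toℕ s))))))
    rest≈0 : sumF F k (expansionTerm M ∘ Fin.suc ∘ Fin.suc ∘ Fin.suc) ≈ 0#
    rest≈0 = sumF≈0 k λ j → expansionTerm≈0ˡ M (Fin.suc (Fin.suc (Fin.suc j))) refl

  V≈bandDet : ∀ m a b → V F m a b ≈ bandDet (shift 1 a) (shift 1 b) (2 ℕ.+ m)
  V≈bandDet 0 a b = refl
  V≈bandDet 1 a b = solve 2 (λ a₁ b₁ →
      :1 :* (a₁ :* :1) :+ :0 := :bandDet (λ _ → a₁) (λ _ → b₁) 3) refl (a 1) (b 1)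
  V≈bandDet 2 a b = solve 4 (λ a₁ a₂ b₁ b₂ →
      :1 :* (a₁ :* (:1 :* (a₂ :* :1) :+ :0)) :+ (:- :1 :* (b₁ :* (:1 :* (:1 :* :1) :+ :0)) :+ :0)
    := :bandDet (λ { 0 → a₁ ; _ → a₂ }) (λ { 0 → b₁ ; _ → b₂ }) 4) refl (a 1) (a 2) (b 1) (b 2)
  V≈bandDet (suc (suc (suc k))) a b = trans (V-firstRow k a b)
    (+-cong (+-cong (*-congˡ (V≈bandDet (suc (suc k)) (shift 1 a) (shift 1 b)))
                    (-‿cong (*-congˡ (V≈bandDet (suc k) (shift 2 a) (shift 2 b)))))
            (V≈bandDet k (shift 3 a) (shift 3 b)))

  V-cong : ∀ m {a b a′ b′} → (∀ r → r < m → a (suc r) ≈ a′ (suc r)) → (∀ r → r < m → b (suc r) ≈ b′ (suc r)) →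
           V F m a b ≈ V F m a′ b′
  V-cong m {a} {b} {a′} {b′} a≈a′ b≈b′ = det-cong m λ r s →
    bandEntry-cong (toℕ r) (toℕ s) (a≈a′ (toℕ r) (Fin.toℕ<n r)) (b≈b′ (toℕ r) (Fin.toℕ<n r))
    where
    bandEntry-cong : ∀ r s → a (suc r) ≈ a′ (suc r) → b (suc r) ≈ b′ (suc r) →
                     bandEntry F a b r s ≈ bandEntry F a′ b′ r s
    bandEntry-cong r s a≈ b≈ with s ℕ.≟ r | s ℕ.≟ suc r | s ℕ.≟ suc (suc r) | r ℕ.≟ suc s
    ... | yes _ | _     | _     | _     = a≈
    ... | no _  | yes _ | _     | _     = b≈
    ... | no _  | no _  | yes _ | _     = refl
    ... | no _  | no _  | no _  | yes _ = refl
    ... | no _  | no _  | no _  | no _  = refl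

everyOther : ∀ {a} {A : Set a} → (ℕ → A) → ℕ → ℕ → A
everyOther z k zero    = z k
everyOther z k (suc i) = everyOther z (2 ℕ.+ k) i

everyOther-≡ : ∀ {a} {A : Set a} (z : ℕ → A) k i → everyOther z k i ≡ z (k ℕ.+ 2 ℕ.* i)
everyOther-≡ z k zero    = ≡.cong z (≡.sym (ℕ.+-identityʳ k))
everyOther-≡ z k (suc i) = ≡.trans (everyOther-≡ z (2 ℕ.+ k) i) (≡.cong z (2+k+2i≡k+2[1+i] k i))
  where
  2+k+2i≡k+2[1+i] : ∀ k i → 2 ℕ.+ k ℕ.+ 2 ℕ.* i ≡ k ℕ.+ 2 ℕ.* suc i
  2+k+2i≡k+2[1+i] = solve-∀

module Frieze {c ℓ} (F : Field c ℓ) where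
  open Field F
  open BandDeterminantProperties commutativeRing
  open IntegerRingSolver commutativeRing
  open import Relation.Binary.Reasoning.Setoid setoid

  x*y≈0⇒x≈0 : ∀ {x y} → ¬ y ≈ 0# → x * y ≈ 0# → x ≈ 0#
  x*y≈0⇒x≈0 {x} {y} y≉0 xy≈0 with inverse y y≉0
  ... | y⁻¹ , yy⁻¹≈1 = begin
    x              ≈⟨ *-identityʳ x ⟨
    x * 1#         ≈⟨ *-congˡ yy⁻¹≈1 ⟨
    x * (y * y⁻¹)  ≈⟨ *-assoc x y y⁻¹ ⟨
    (x * y) * y⁻¹  ≈⟨ *-congʳ xy≈0 ⟩
    0# * y⁻¹       ≈⟨ zeroˡ y⁻¹ ⟩
    0#             ∎

  x≈y-z⇒z≈y-x : ∀ {x y z} → x ≈ y - z → z ≈ y - x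
  x≈y-z⇒z≈y-x {x} {y} {z} x≈y-z = begin
    z            ≈⟨ solve 2 (λ y z → z := y :- (y :- z)) refl y z ⟩
    y - (y - z)  ≈⟨ +-congˡ (-‿cong x≈y-z) ⟨
    y - x        ∎

  -- frieze z k (2 + l) = V(z k, z (k + 1), …, z (k + 2l − 2)), the entry D(k,l) of the array above.
  frieze : (ℕ → Carrier) → ℕ → ℕ → Carrier
  frieze z k = bandDet (everyOther z k) (everyOther z (suc k))

  frieze-condensation : ∀ z k l → frieze z (suc k) (suc l) ≈
    frieze z k (suc l) * frieze z (2 ℕ.+ k) (suc l) - frieze z k (2 ℕ.+ l) * frieze z (2 ℕ.+ k) l
  frieze-condensation z k l = bandDet-condensation l (everyOther z k) (everyOther z (suc k))

  module _ (z : ℕ → Carrier) (N m : ℕ)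
           (nonzero : ∀ k → k < N → ¬ frieze z k (2 ℕ.+ m) ≈ 0#)
           (unit : ∀ k → k < N → frieze z k (3 ℕ.+ m) ≈ 1#) where

    frieze-4+m≈0 : ∀ k → 2 ℕ.+ k < N → frieze z k (4 ℕ.+ m) ≈ 0#
    frieze-4+m≈0 k 2+k<N = x*y≈0⇒x≈0 (nonzero (2 ℕ.+ k) 2+k<N) (begin
      frieze z k (4 ℕ.+ m) * frieze z (2 ℕ.+ k) (2 ℕ.+ m)
        ≈⟨ x≈y-z⇒z≈y-x (frieze-condensation z k (2 ℕ.+ m)) ⟩
      frieze z k (3 ℕ.+ m) * frieze z (2 ℕ.+ k) (3 ℕ.+ m) - frieze z (suc k) (3 ℕ.+ m)
        ≈⟨ +-cong (*-cong (unit k (ℕ.m+n≤o⇒n≤o 2 2+k<N)) (unit (2 ℕ.+ k) 2+k<N))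
                  (-‿cong (unit (suc k) (ℕ.m+n≤o⇒n≤o 1 2+k<N))) ⟩
      1# * 1# - 1#
        ≈⟨ solve 0 (:1 :* :1 :- :1 := :0) refl ⟩
      0#  ∎)

    frieze-5+m≈0 : ∀ k → 3 ℕ.+ k < N → frieze z k (5 ℕ.+ m) ≈ 0#
    frieze-5+m≈0 k 3+k<N = x*y≈0⇒x≈0 (1≉0 ∘ trans (sym (unit (2 ℕ.+ k) 2+k<N))) (begin
      frieze z k (5 ℕ.+ m) * frieze z (2 ℕ.+ k) (3 ℕ.+ m)
        ≈⟨ x≈y-z⇒z≈y-x (frieze-condensation z k (3 ℕ.+ m)) ⟩
      frieze z k (4 ℕ.+ m) * frieze z (2 ℕ.+ k) (4 ℕ.+ m) - frieze z (suc k) (4 ℕ.+ m)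
        ≈⟨ +-cong (*-congʳ (frieze-4+m≈0 k 2+k<N)) (-‿cong (frieze-4+m≈0 (suc k) 3+k<N)) ⟩
      0# * frieze z (2 ℕ.+ k) (4 ℕ.+ m) - 0#
        ≈⟨ solve 1 (λ x → :0 :* x :- :0 := :0) refl _ ⟩
      0#  ∎)
      where
      2+k<N : 2 ℕ.+ k < N
      2+k<N = ℕ.m+n≤o⇒n≤o 1 3+k<N

    frieze-6+m≈1 : ∀ k → 3 ℕ.+ k < N → frieze z k (6 ℕ.+ m) ≈ 1#
    frieze-6+m≈1 k 3+k<N = begin
      frieze z k (6 ℕ.+ m)
        ≈⟨ bandDet-expandʳ (2 ℕ.+ m) (everyOther z k) (everyOther z (suc k)) ⟩
      a * frieze z k (5 ℕ.+ m) - b * frieze z k (4 ℕ.+ m) + frieze z k (3 ℕ.+ m)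
        ≈⟨ +-cong (+-cong (*-congˡ (frieze-5+m≈0 k 3+k<N)) (-‿cong (*-congˡ (frieze-4+m≈0 k 2+k<N))))
                  (unit k (ℕ.m+n≤o⇒n≤o 3 3+k<N)) ⟩
      a * 0# - b * 0# + 1#
        ≈⟨ solve 2 (λ a b → a :* :0 :- b :* :0 :+ :1 := :1) refl a b ⟩
      1#  ∎
      where
      2+k<N : 2 ℕ.+ k < N
      2+k<N = ℕ.m+n≤o⇒n≤o 1 3+k<N
      a = everyOther z k (3 ℕ.+ m)
      b = everyOther z (suc k) (2 ℕ.+ m)

    frieze-periodic : ∀ k → 8 ℕ.+ k < N → z (k ℕ.+ 2 ℕ.* (4 ℕ.+ m)) ≈ z k
    frieze-periodic k 8+k<N = begin
      z (k ℕ.+ 2 ℕ.* (4 ℕ.+ m))     ≡⟨ everyOther-≡ z k (4 ℕ.+ m) ⟨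
      a                             ≈⟨ solve 2 (λ a b → a := a :* :1 :- b :* :0 :+ :0) refl a b ⟩
      a * 1# - b * 0# + 0#
        ≈⟨ +-cong (+-cong (*-congˡ (frieze-6+m≈1 k 3+k<N)) (-‿cong (*-congˡ (frieze-5+m≈0 k 3+k<N))))
                  (frieze-4+m≈0 k (ℕ.m+n≤o⇒n≤o 1 3+k<N)) ⟨
      a * frieze z k (6 ℕ.+ m) - b * frieze z k (5 ℕ.+ m) + frieze z k (4 ℕ.+ m)
        ≈⟨ bandDet-expandʳ (3 ℕ.+ m) (everyOther z k) (everyOther z (suc k)) ⟨
      frieze z k (7 ℕ.+ m)
        ≡⟨⟩
      z k * frieze z (2 ℕ.+ k) (6 ℕ.+ m) - z (suc k) * frieze z (4 ℕ.+ k) (5 ℕ.+ m)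
      + frieze z (6 ℕ.+ k) (4 ℕ.+ m)
        ≈⟨ +-cong (+-cong (*-congˡ (frieze-6+m≈1 (2 ℕ.+ k) (ℕ.m+n≤o⇒n≤o 3 8+k<N)))
                          (-‿cong (*-congˡ (frieze-5+m≈0 (4 ℕ.+ k) (ℕ.m+n≤o⇒n≤o 1 8+k<N)))))
                  (frieze-4+m≈0 (6 ℕ.+ k) 8+k<N) ⟩
      z k * 1# - z (suc k) * 0# + 0#
        ≈⟨ solve 2 (λ x y → x :* :1 :- y :* :0 :+ :0 := x) refl (z k) (z (suc k)) ⟩
      z k  ∎
      where
      3+k<N : 3 ℕ.+ k < N
      3+k<N = ℕ.m+n≤o⇒n≤o 5 8+k<N
      a = everyOther z k (4 ℕ.+ m)
      b = everyOther z (suc k) (3 ℕ.+ m)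

module ShiftRegister {c ℓ} (F : Field c ℓ) where
  open Field F
  open import Relation.Binary.Reasoning.Setoid setoid

  at-toℕ : ∀ {d} (x : Fin d → Carrier) j → at F x (toℕ j) ≡ x j
  at-toℕ x Fin.zero    = ≡.refl
  at-toℕ x (Fin.suc j) = at-toℕ (x ∘ Fin.suc) j

  module _ (e N : ℕ) (xs : ℕ → Fin (suc e) → Carrier)
           (shifted : ∀ k → k < N → ∀ j → j < e → at F (xs (suc k)) j ≈ at F (xs k) (suc j)) where

    unrolled : ℕ → Carrier
    unrolled q with q ℕ.≤? e
    ... | yes _ = at F (xs 0) q
    ... | no _  = at F (xs (q ∸ e)) e

    at≈unrolled : ∀ k j → k ≤ N → j ≤ e → at F (xs k) j ≈ unrolled (k ℕ.+ j)
    at≈unrolled zero j _ j≤e with j ℕ.≤? e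
    ... | yes _   = refl
    ... | no j≰e = contradiction j≤e j≰e
    at≈unrolled (suc k) j k<N j≤e with ℕ.m≤n⇒m<n∨m≡n j≤e
    ... | inj₁ j<e = begin
      at F (xs (suc k)) j        ≈⟨ shifted k k<N j j<e ⟩
      at F (xs k) (suc j)        ≈⟨ at≈unrolled k (suc j) (ℕ.<⇒≤ k<N) j<e ⟩
      unrolled (k ℕ.+ suc j)     ≡⟨ ≡.cong unrolled (ℕ.+-suc k j) ⟩
      unrolled (suc k ℕ.+ j)     ∎
    ... | inj₂ ≡.refl with suc k ℕ.+ j ℕ.≤? j
    ...   | yes 1+k+j≤j = contradiction 1+k+j≤j (ℕ.<⇒≱ (ℕ.m<n+m j ℕ.z<s))
    ...   | no _        = reflexive (≡.cong (λ t → at F (xs t) j) (≡.sym (ℕ.m+n∸n≡m (suc k) j)))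

-- For n = 5 + p the paper's m = n − 4 is suc p, and e = 2m − 1 indexes the last coordinate.
module PhiOrbit {c ℓ} (F : Field c ℓ) (p : ℕ)
  (xs : ℕ → Fin (dim F (5 ℕ.+ p)) → Field.Carrier F)
  (step : ∀ k → k < 2 ℕ.* (5 ℕ.+ p) → PhiStep F (5 ℕ.+ p) (xs k) (xs (suc k))) where
  open Field F
  open BandDeterminantProperties commutativeRing
  open IntegerRingSolver commutativeRing
  open Frieze F
  open BandMatrix F
  open ShiftRegister F
  open import Relation.Binary.Reasoning.Setoid setoid

  N e : ℕ
  N = 2 ℕ.* (5 ℕ.+ p)
  e = 2 ℕ.* suc p ∸ 1

  shifted : ∀ k → k < N → ∀ j → j < e → at F (xs (suc k)) j ≈ at F (xs k) (suc j)
  shifted k k<N j j<e = begin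
    at F (xs (suc k)) j            ≡⟨ ≡.cong (at F (xs (suc k))) (Fin.toℕ-fromℕ< j<1+e) ⟨
    at F (xs (suc k)) (toℕ j′)     ≡⟨ at-toℕ (xs (suc k)) j′ ⟩
    xs (suc k) j′                  ≈⟨ proj₁ (proj₂ (step k k<N)) j′ 1+j′<1+e ⟩
    at F (xs k) (suc (toℕ j′))     ≡⟨ ≡.cong (λ i → at F (xs k) (suc i)) (Fin.toℕ-fromℕ< j<1+e) ⟩
    at F (xs k) (suc j)            ∎
    where
    j<1+e : j < suc e
    j<1+e = ℕ.m<n⇒m<1+n j<e
    j′ = Fin.fromℕ< j<1+e
    1+j′<1+e : suc (toℕ j′) < suc e
    1+j′<1+e = ≡.subst (λ i → suc i < suc e) (≡.sym (Fin.toℕ-fromℕ< j<1+e)) (ℕ.s≤s j<e)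

  orbitSeq : ℕ → Carrier
  orbitSeq = unrolled e N xs shifted

  private
    2r≤e : ∀ {r} → r ≤ p → 2 ℕ.* r ≤ e
    2r≤e {r} r≤p = ℕ.≤-trans (ℕ.*-monoʳ-≤ 2 r≤p) (ℕ.+-monoʳ-≤ p (ℕ.n≤1+n (p ℕ.+ 0)))

    2[1+r]∸1≤e : ∀ {r} → r ≤ p → 2 ℕ.* suc r ∸ 1 ≤ e
    2[1+r]∸1≤e r≤p = ℕ.∸-monoˡ-≤ 1 (ℕ.*-monoʳ-≤ 2 (ℕ.s≤s r≤p))

    k+[2[1+r]∸1]≡1+k+2r : ∀ k r → k ℕ.+ (2 ℕ.* suc r ∸ 1) ≡ suc k ℕ.+ 2 ℕ.* r
    k+[2[1+r]∸1]≡1+k+2r k r = ≡.trans (≡.cong (k ℕ.+_) (ℕ.+-suc r (r ℕ.+ 0))) (ℕ.+-suc k (2 ℕ.* r))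

  aCoord-orbit : ∀ k r → k < N → r ≤ p → aCoord F (xs k) (suc r) ≈ everyOther orbitSeq k r
  aCoord-orbit k r k<N r≤p = begin
    at F (xs k) (2 ℕ.* r)     ≈⟨ at≈unrolled e N xs shifted k (2 ℕ.* r) (ℕ.<⇒≤ k<N) (2r≤e r≤p) ⟩
    orbitSeq (k ℕ.+ 2 ℕ.* r)  ≡⟨ everyOther-≡ orbitSeq k r ⟨
    everyOther orbitSeq k r   ∎

  bCoord-orbit : ∀ k r → k < N → r ≤ p → bCoord F (xs k) (suc r) ≈ everyOther orbitSeq (suc k) r
  bCoord-orbit k r k<N r≤p = begin
    at F (xs k) (2 ℕ.* suc r ∸ 1)       ≈⟨ at≈unrolled e N xs shifted k _ (ℕ.<⇒≤ k<N) (2[1+r]∸1≤e r≤p) ⟩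
    orbitSeq (k ℕ.+ (2 ℕ.* suc r ∸ 1))  ≡⟨ ≡.cong orbitSeq (k+[2[1+r]∸1]≡1+k+2r k r) ⟩
    orbitSeq (suc k ℕ.+ 2 ℕ.* r)        ≡⟨ everyOther-≡ orbitSeq (suc k) r ⟨
    everyOther orbitSeq (suc k) r       ∎

  V-orbit : ∀ k l → k < N → l ≤ suc p →
            V F l (aCoord F (xs k)) (bCoord F (xs k)) ≈ frieze orbitSeq k (2 ℕ.+ l)
  V-orbit k l k<N l≤1+p = trans
    (V-cong l {a′ = λ i → everyOther orbitSeq k (i ∸ 1)} {b′ = λ i → everyOther orbitSeq (suc k) (i ∸ 1)}
       (λ r r<l → aCoord-orbit k r k<N (ℕ.m<1+n⇒m≤n (ℕ.<-≤-trans r<l l≤1+p)))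
       (λ r r<l → bCoord-orbit k r k<N (ℕ.m<1+n⇒m≤n (ℕ.<-≤-trans r<l l≤1+p))))
    (V≈bandDet l _ _)

  W-orbit : ∀ k q → k < N → q ≤ p →
            W F q (aCoord F (xs k)) (bCoord F (xs k)) ≈ frieze orbitSeq k (suc q)
  W-orbit k zero    k<N _     = refl
  W-orbit k (suc q) k<N q<p = V-orbit k q k<N (ℕ.≤-trans (ℕ.n≤1+n q) (ℕ.m≤n⇒m≤1+n q<p))

  frieze-nonzero : ∀ k → k < N → ¬ frieze orbitSeq k (3 ℕ.+ p) ≈ 0#
  frieze-nonzero k k<N = proj₁ (step k k<N) ∘ trans (V-orbit k (suc p) k<N ℕ.≤-refl)

  frieze-unit : ∀ k → k < N → frieze orbitSeq k (4 ℕ.+ p) ≈ 1#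
  frieze-unit k k<N = begin
    D (4 ℕ.+ p)
      ≈⟨ bandDet-expandʳ p (everyOther orbitSeq k) (everyOther orbitSeq (suc k)) ⟩
    everyOther orbitSeq k (suc p) * D (3 ℕ.+ p) - everyOther orbitSeq (suc k) p * D (2 ℕ.+ p) + D (suc p)
      ≈⟨ +-cong (+-cong (*-cong (sym y≈) (sym (V-orbit k (suc p) k<N ℕ.≤-refl)))
                        (-‿cong (*-cong (sym (bCoord-orbit k p k<N ℕ.≤-refl))
                                        (sym (V-orbit k p k<N (ℕ.n≤1+n p))))))
                (sym (W-orbit k p k<N ℕ.≤-refl)) ⟩
    y * v - β * v′ + w
      ≈⟨ solve 5 (λ y v β v′ w → y :* v :- β :* v′ :+ w := v :* y :- β :* v′ :+ w) refl y v β v′ w ⟩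
    v * y - β * v′ + w
      ≈⟨ +-congʳ (+-congʳ (proj₂ (proj₂ (step k k<N)) last (≡.cong suc (Fin.toℕ-fromℕ e)))) ⟩
    (1# + β * v′) - w - β * v′ + w
      ≈⟨ solve 3 (λ β v′ w → (:1 :+ β :* v′) :- w :- β :* v′ :+ w := :1) refl β v′ w ⟩
    1#  ∎
    where
    D = frieze orbitSeq k
    x = xs k
    last : Fin (suc e)
    last = Fin.fromℕ e
    y = xs (suc k) last
    v = V F (suc p) (aCoord F x) (bCoord F x)
    v′ = V F p (aCoord F x) (bCoord F x)
    β = bCoord F x (suc p)
    w = W F p (aCoord F x) (bCoord F x)
    y≈ : y ≈ everyOther orbitSeq k (suc p)
    y≈ = begin
      y                              ≡⟨ at-toℕ (xs (suc k)) last ⟨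
      at F (xs (suc k)) (toℕ last)   ≡⟨ ≡.cong (at F (xs (suc k))) (Fin.toℕ-fromℕ e) ⟩
      at F (xs (suc k)) e            ≈⟨ at≈unrolled e N xs shifted (suc k) e k<N ℕ.≤-refl ⟩
      orbitSeq (suc k ℕ.+ e)         ≡⟨ ≡.cong (orbitSeq ∘ suc) (k+[2[1+r]∸1]≡1+k+2r k p) ⟩
      orbitSeq (2 ℕ.+ k ℕ.+ 2 ℕ.* p) ≡⟨ everyOther-≡ orbitSeq (2 ℕ.+ k) p ⟨
      everyOther orbitSeq k (suc p)  ∎

open import Data.Nat.Base using (_*_)

corollary7p3 : ∀ {c ℓ} (F : Field c ℓ) → CharZero F → (n : ℕ) → 5 ≤ n →
    (xs : ℕ → Fin (dim F n) → Field.Carrier F) →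
    (∀ k → k < 2 * n → PhiStep F n (xs k) (xs (suc k))) →
    ∀ (j : Fin (dim F n)) → Field._≈_ F (xs (2 * n) j) (xs 0 j)
corollary7p3 F _ (suc (suc (suc (suc (suc p))))) _ xs step j = begin
  xs N j                          ≡⟨ at-toℕ (xs N) j ⟨
  at F (xs N) (toℕ j)             ≈⟨ at≈unrolled e N xs shifted N (toℕ j) ℕ.≤-refl j≤e ⟩
  orbitSeq (N ℕ.+ toℕ j)          ≡⟨ ≡.cong orbitSeq (ℕ.+-comm N (toℕ j)) ⟩
  orbitSeq (toℕ j ℕ.+ N)          ≈⟨ frieze-periodic orbitSeq N (suc p) frieze-nonzero frieze-unit (toℕ j) 8+j<N ⟩
  orbitSeq (toℕ j)                ≈⟨ at≈unrolled e N xs shifted 0 (toℕ j) ℕ.z≤n j≤e ⟨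
  at F (xs 0) (toℕ j)             ≡⟨ at-toℕ (xs 0) j ⟩
  xs 0 j                          ∎
  where
  open Field F
  open Frieze F
  open ShiftRegister F
  open PhiOrbit F p xs step
  open import Relation.Binary.Reasoning.Setoid setoid
  j≤e : toℕ j ≤ e
  j≤e = ℕ.m<1+n⇒m≤n (Fin.toℕ<n j)
  8+j<N : 8 ℕ.+ toℕ j < N
  8+j<N = ℕ.<-≤-trans (ℕ.+-monoʳ-< 8 (Fin.toℕ<n j)) (ℕ.≤-reflexive (≡.sym (ℕ.*-distribˡ-+ 2 4 (suc p))))
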